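{- Let $G$ be a finite undirected graph with vertex set $V$, and $A$ an abelian group. For any $v\in V$ and $a\in A$, the function $g:V\to A$ with $g(v)=2a$ and $g(w)=0$ for all $w\neq v$ is balanceable.
   Context: Graphs are finite, undirected, may have multiple edges and loops, and need not be connected, with edge set $E$. A truncated trail (ttrail) from $x$ to $y$ is a sequence $v_1,e_1,\dots,v_n,e_n$ with $v_1=x$, each $e_j$ joining $v_j$ and $v_{j+1}$ (where $v_{n+1}=y$), edges pairwise distinct; it is closed if $x=y$. $g:V\to A$ is balanceable if there is $f:E\to A$ with $g(v_1)+f(e_1)+\dots+g(v_n)+f(e_n)=0$ for every closed ttrail $v_1,e_1,\dots,v_n,e_n$. -}

module Defs where

open import Level using (Level; _⊔_)
open import Data.Nat using (ℕ)
open import Data.Fin using (Fin)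
open import Data.Product using (_×_; _,_; Σ)
open import Data.Sum using (_⊎_)
open import Data.List using (List; []; _∷_)
open import Data.List.Relation.Unary.Unique.Propositional using (Unique)
open import Relation.Binary.PropositionalEquality using (_≡_)
open import Algebra.Bundles using (AbelianGroup)

-- A finite multigraph (loops and parallel edges allowed, not nec. connected):
-- vertices Fin nV, edges Fin nE, each edge has an (unordered) pair of ends.
record Graph : Set where
  field
    nV   : ℕ
    nE   : ℕ
    ends : Fin nE → Fin nV × Fin nV

module _ (G : Graph) where
  open Graph G

  Joins : Fin nE → Fin nV → Fin nV → Set
  Joins e u w = (ends e ≡ (u , w)) ⊎ (ends e ≡ (w , u))

  data Walk : Fin nV → Fin nV → Set where
    []   : ∀ {x} → Walk x x
    step : ∀ {x w y} (e : Fin nE) → Joins e x w → Walk w y → Walk x y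

  edges : ∀ {x y} → Walk x y → List (Fin nE)
  edges []             = []
  edges (step e _ t)   = e ∷ edges t

  IsTTrail : ∀ {x y} → Walk x y → Set
  IsTTrail t = Unique (edges t)

module _ (G : Graph) {c ℓ : Level} (A : AbelianGroup c ℓ) where
  open Graph G
  open AbelianGroup A

  weight : (Fin nV → Carrier) → (Fin nE → Carrier) → ∀ {x y} → Walk G x y → Carrier
  weight g f []                    = ε
  weight g f (step {x = x} e _ t)  = (g x ∙ f e) ∙ weight g f t

  Balanceable : (Fin nV → Carrier) → Set (c ⊔ ℓ)
  Balanceable g = Σ (Fin nE → Carrier) λ f →
    ∀ (x : Fin nV) (t : Walk G x x) → IsTTrail G t → weight g f t ≈ ε

-- Write g = h + h with h the point mass a at v. Giving the edge uw the value
-- −h(u) − h(w) makes each summand g(u) + f(e) of a walk equal to h(u) − h(w),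
-- so the weight of every walk telescopes to h(start) − h(end), which vanishes
-- on closed walks.
module Submission where

open import Defs
open import Level using (Level)
open import Data.Bool using (if_then_else_; true; false)
open import Data.Fin using (Fin; _≟_)
open import Data.Product using (_×_; _,_)
open import Data.Sum using (inj₁; inj₂)
open import Relation.Nullary.Decidable using (⌊_⌋)
open import Relation.Binary.PropositionalEquality using (cong)
open import Algebra.Bundles using (AbelianGroup)
import Relation.Binary.Reasoning.Setoid as SetoidReasoning

module _ {c ℓ : Level} (A : AbelianGroup c ℓ) where
  open AbelianGroup A
  open SetoidReasoning setoid

  xx∙x⁻¹y≈xy : ∀ x y → (x ∙ x) ∙ (x ⁻¹ ∙ y) ≈ x ∙ y
  xx∙x⁻¹y≈xy x y = begin
    (x ∙ x) ∙ (x ⁻¹ ∙ y)  ≈⟨ assoc x x (x ⁻¹ ∙ y) ⟩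
    x ∙ (x ∙ (x ⁻¹ ∙ y))  ≈⟨ ∙-congˡ (assoc x (x ⁻¹) y) ⟨
    x ∙ ((x ∙ x ⁻¹) ∙ y)  ≈⟨ ∙-congˡ (∙-congʳ (inverseʳ x)) ⟩
    x ∙ (ε ∙ y)           ≈⟨ ∙-congˡ (identityˡ y) ⟩
    x ∙ y                 ∎

  x∙y⁻¹∙y∙z≈x∙z : ∀ x y z → (x ∙ y ⁻¹) ∙ (y ∙ z) ≈ x ∙ z
  x∙y⁻¹∙y∙z≈x∙z x y z = begin
    (x ∙ y ⁻¹) ∙ (y ∙ z)  ≈⟨ assoc x (y ⁻¹) (y ∙ z) ⟩
    x ∙ (y ⁻¹ ∙ (y ∙ z))  ≈⟨ ∙-congˡ (assoc (y ⁻¹) y z) ⟨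
    x ∙ ((y ⁻¹ ∙ y) ∙ z)  ≈⟨ ∙-congˡ (∙-congʳ (inverseˡ y)) ⟩
    x ∙ (ε ∙ z)           ≈⟨ ∙-congˡ (identityˡ z) ⟩
    x ∙ z                 ∎

  module _ (G : Graph) where
    open Graph G

    negatedSum : (Fin nV → Carrier) → Fin nV × Fin nV → Carrier
    negatedSum h (u , w) = h u ⁻¹ ∙ h w ⁻¹

    edgeWeight : (Fin nV → Carrier) → Fin nE → Carrier
    edgeWeight h e = negatedSum h (ends e)

    edgeWeight-joins : ∀ h {e u w} → Joins G e u w →
                       edgeWeight h e ≈ h u ⁻¹ ∙ h w ⁻¹
    edgeWeight-joins h (inj₁ ends≡uw) = reflexive (cong (negatedSum h) ends≡uw)
    edgeWeight-joins h {u = u} {w} (inj₂ ends≡wu) = begin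
      edgeWeight h _   ≈⟨ reflexive (cong (negatedSum h) ends≡wu) ⟩
      h w ⁻¹ ∙ h u ⁻¹  ≈⟨ comm (h w ⁻¹) (h u ⁻¹) ⟩
      h u ⁻¹ ∙ h w ⁻¹  ∎

    module _ {g h : Fin nV → Carrier} (g≈h+h : ∀ x → g x ≈ h x ∙ h x) where

      weight-telescopes : ∀ {x y} (t : Walk G x y) →
                          weight G A g (edgeWeight h) t ≈ h x ∙ h y ⁻¹
      weight-telescopes {x} [] = sym (inverseʳ (h x))
      weight-telescopes {x} {y} (step {w = w} e x~w t) = begin
        (g x ∙ edgeWeight h e) ∙ weight G A g (edgeWeight h) t
          ≈⟨ ∙-cong (∙-cong (g≈h+h x) (edgeWeight-joins h x~w)) (weight-telescopes t) ⟩
        ((h x ∙ h x) ∙ (h x ⁻¹ ∙ h w ⁻¹)) ∙ (h w ∙ h y ⁻¹)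
          ≈⟨ ∙-congʳ (xx∙x⁻¹y≈xy (h x) (h w ⁻¹)) ⟩
        (h x ∙ h w ⁻¹) ∙ (h w ∙ h y ⁻¹)
          ≈⟨ x∙y⁻¹∙y∙z≈x∙z (h x) (h w) (h y ⁻¹) ⟩
        h x ∙ h y ⁻¹
          ∎

      doubled-balanceable : Balanceable G A g
      doubled-balanceable =
        edgeWeight h , λ x t _ → trans (weight-telescopes t) (inverseʳ (h x))

mainTheorem10 : {c ℓ : Level} (G : Graph) (A : AbelianGroup c ℓ)
    (v : Fin (Graph.nV G)) (a : AbelianGroup.Carrier A) →
    Balanceable G A (λ w → if ⌊ w ≟ v ⌋ then AbelianGroup._∙_ A a a else AbelianGroup.ε A)
mainTheorem10 G A v a = doubled-balanceable A G pointMass-doubled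
  where
  open AbelianGroup A

  pointMass : Fin (Graph.nV G) → Carrier
  pointMass w = if ⌊ w ≟ v ⌋ then a else ε

  pointMass-doubled : ∀ w → (if ⌊ w ≟ v ⌋ then a ∙ a else ε) ≈ pointMass w ∙ pointMass w
  pointMass-doubled w with ⌊ w ≟ v ⌋
  ... | true  = refl
  ... | false = sym (identityˡ ε)
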